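{- Let $G=(V,E)$ be a fork-free graph and $I$ an independent set of $G$ such that no vertex of $G$ is adjacent to three or more vertices of $I$. Let $M$ be a non-trivial module of $G$ and let $C_1,\dots,C_\ell$ be the connected components of $G[M]$. Suppose $\ell\ge 2$ and $M\cap I=\{v\}\subseteq V(C_1)$. Then exactly one of the following holds: (i) $v$ has a neighbor $c\in V\setminus M$ with $N(c)\cap I=\{v\}$; (ii) $N(M)\setminus M$ is permanently blocked with respect to $I$; in particular $|I'\cap V(C_1)|=1$ for every independent set $I'$ of $G$ such that $I\leftrightsquigarrow I'$.
   Context: A module of $G$ is a set $M\subseteq V$ such that each vertex outside $M$ is adjacent to all or to none of $M$; it is non-trivial if $M\neq\emptyset$ and $M\neq V$. A fork is the claw with one edge subdivided once. Two independent sets $A,B$ are TS-adjacent if $A\setminus B=\{x\}$, $B\setminus A=\{y\}$ and $xy\in E$; $A\leftrightsquigarrow B$ means there is a sequence of independent sets from $A$ to $B$ with consecutive sets TS-adjacent. A set $X$ is locally blocked w.r.t. $I$ if every vertex of $X$ has at least two neighbors in $I$. For $u\in V$, $X\subseteq V\setminus\{u\}$, a vertex $v\notin X\cup\{u\}$ is an $X$-twin of $u$ if $uv\in E$ and $N(v)\cap X=N(u)\cap X$. For an independent set $I'$ and $u\in I'$, an $I'$-free neighbor of $u$ is a vertex $v\notin I'$ adjacent to $u$ with $(I'\setminus\{u\})\cup\{v\}$ independent. $X$ is permanently blocked w.r.t. $I$ if it is locally blocked w.r.t. $I$ and for every independent $I'$ with $I\leftrightsquigarrow I'$ and every $u\in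 N(X)\cap I'$, every $I'$-free neighbor of $u$ is an $X$-twin of $u$. -}

module Defs where

open import Data.Bool using (Bool; true; false)
open import Data.Nat using (ℕ; _≤_; _≥_)
open import Data.Fin using (Fin)
open import Data.Fin.Subset using (Subset; _∈_; _∉_; _∩_; _∪_; _─_; _-_; ⁅_⁆; ∣_∣)
open import Data.Vec using (tabulate)
open import Data.Product using (Σ; ∃; ∃-syntax; _×_; _,_)
open import Data.Sum using (_⊎_)
open import Relation.Nullary using (¬_)
open import Relation.Binary.PropositionalEquality using (_≡_; _≢_)
open import Relation.Binary.Construct.Closure.ReflexiveTransitive using (Star)
open import Function.Bundles using (_⇔_)

record Graph : Set where
  field
    n      : ℕ
    adj    : Fin n → Fin n → Bool
    sym    : ∀ x y → adj x y ≡ adj y x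
    irrefl : ∀ x → adj x x ≡ false

module _ (G : Graph) where
  open Graph G

  V : Set
  V = Fin n

  Adj : V → V → Set
  Adj x y = adj x y ≡ true

  nbr : V → Subset n
  nbr x = tabulate (adj x)

  VPred : Set₁
  VPred = V → Set

  N : VPred → VPred
  N X u = ∃[ y ] (X y × Adj u y)

  Independent : Subset n → Set
  Independent S = ∀ x y → x ∈ S → y ∈ S → ¬ Adj x y

  -- induced fork (claw with one edge subdivided): centre a, leaves b c,
  -- path a - d - e; exactly these four edges among five distinct vertices.
  IsFork : V → V → V → V → V → Set
  IsFork a b c d e =
    (a ≢ b) × (a ≢ c) × (a ≢ d) × (a ≢ e) × (b ≢ c) × (b ≢ d) × (b ≢ e)
    × (c ≢ d) × (c ≢ e) × (d ≢ e)
    × Adj a b × Adj a c × Adj a d × Adj d e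
    × ¬ Adj a e × ¬ Adj b c × ¬ Adj b d × ¬ Adj b e × ¬ Adj c d × ¬ Adj c e

  ForkFree : Set
  ForkFree = ∀ a b c d e → ¬ IsFork a b c d e

  IsModule : Subset n → Set
  IsModule M = ∀ x → x ∉ M → (∀ y → y ∈ M → Adj x y) ⊎ (∀ y → y ∈ M → ¬ Adj x y)

  NonTrivial : Subset n → Set
  NonTrivial M = (∃[ x ] x ∈ M) × (∃[ x ] x ∉ M)

  AdjIn : Subset n → V → V → Set
  AdjIn M x y = x ∈ M × y ∈ M × Adj x y

  Component : Subset n → V → VPred
  Component M v x = x ∈ M × Star (AdjIn M) v x

  TSAdj : Subset n → Subset n → Set
  TSAdj A B = Independent A × Independent B ×
    ∃[ x ] ∃[ y ] (Adj x y × (A ─ B ≡ ⁅ x ⁆) × (B ─ A ≡ ⁅ y ⁆))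

  -- A ⇝ B : reconfiguration sequence under token sliding
  TSReach : Subset n → Subset n → Set
  TSReach = Star TSAdj

  LocallyBlocked : VPred → Subset n → Set
  LocallyBlocked X I = ∀ x → X x → 2 ≤ ∣ I ∩ nbr x ∣

  Twin : VPred → V → V → Set
  Twin X u v = ¬ X v × v ≢ u × Adj u v × (∀ w → X w → (Adj v w ⇔ Adj u w))

  FreeNbr : Subset n → V → V → Set
  FreeNbr I' u v = v ∉ I' × Adj u v × Independent ((I' - u) ∪ ⁅ v ⁆)

  PermanentlyBlocked : VPred → Subset n → Set
  PermanentlyBlocked X I = LocallyBlocked X I ×
    (∀ I' → Independent I' → TSReach I I' →
      ∀ u → N X u → u ∈ I' → ∀ v → FreeNbr I' u v → Twin X u v)

ExactlyOne : Set → Set → Set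
ExactlyOne P Q = (P ⊎ Q) × ¬ (P × Q)

{-# OPTIONS --safe #-}
module Submission where

-- Outside the module M, vertices are either boundary vertices (in N(M) ∖ M, hence
-- complete to M) or remote ones (anticomplete to M).  Since M contains two
-- non-adjacent vertices p, q (from different components of G[M]), fork-freeness
-- forces a boundary vertex x adjacent to one end of an edge ab between remote
-- vertices to be adjacent to the other end, for otherwise x, p, q, a, b is a fork.
--
-- If (i) fails, every boundary vertex has a neighbour in I outside M.  Together
-- with "I meets M in exactly one vertex, which lies in the component of v", this
-- is preserved by token sliding: a token in M can only slide inside M, since a
-- boundary vertex always sees some other token; a token outside M is remote and
-- slides to a remote vertex, which by the fork argument dominates whatever the old
-- position dominated on the boundary.  The same two observations make every free
-- neighbour of a token a twin of it with respect to the boundary.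

open import Defs
open import Data.Bool using (true) renaming (_≟_ to _≟ᴮ_)
open import Data.Empty using (⊥-elim)
open import Data.Fin using (Fin) renaming (_≟_ to _≟ᶠ_)
open import Data.Fin.Properties using (any?)
open import Data.Fin.Subset using (Subset; _∈_; _∉_; _∩_; _∪_; _─_; _-_; ⁅_⁆; ∣_∣; _⊆_; outside)
open import Data.Fin.Subset.Properties
  using (_∈?_; x∈⁅x⁆; x∈⁅y⁆⇒x≡y; x≢y⇒x∉⁅y⁆; ∣⁅x⁆∣≡1; ⊆-antisym; p⊆q⇒∣p∣≤∣q∣; x∈p⇒∣p-x∣<∣p∣;
         x∈p∩q⁺; x∈p∩q⁻; x∈p∪q⁺; x∈p∧x∉q⇒x∈p─q; p─q⊆p)
open import Data.Nat using (ℕ; _≤_; s≤s)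
open import Data.Nat.Properties using (≤-trans)
open import Data.Product using (∃-syntax; _×_; _,_; proj₁; proj₂)
open import Data.Sum using (inj₁; inj₂; [_,_]′)
open import Data.Vec using (_∷_; here; there)
open import Data.Vec.Properties using (lookup∘tabulate; []=⇒lookup; lookup⇒[]=; ≡-dec)
open import Function using (_∘_)
open import Function.Bundles using (mk⇔)
open import Relation.Binary.Definitions using (Decidable)
open import Relation.Binary.PropositionalEquality using (_≡_; _≢_; refl; sym; trans; subst; cong)
open import Relation.Binary.Construct.Closure.ReflexiveTransitive using (Star; ε; _◅_; _◅◅_)
open import Relation.Nullary using (¬_; Dec; yes; no; ¬?)
open import Relation.Nullary.Decidable using (_×-dec_; toSum)

ExactlyOne-intro : ∀ {P Q : Set} → Dec P → (¬ P → Q) → (Q → ¬ P) → ExactlyOne P Q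
ExactlyOne-intro (yes p) _     Q⇒¬P = inj₁ p , λ (p , q) → Q⇒¬P q p
ExactlyOne-intro (no ¬p) ¬P⇒Q Q⇒¬P = inj₂ (¬P⇒Q ¬p) , λ (p , q) → Q⇒¬P q p

x∈p─q⇒x∉q : ∀ {n} {x : Fin n} (p q : Subset n) → x ∈ p ─ q → x ∉ q
x∈p─q⇒x∉q (_ ∷ p) (outside ∷ q) here       = λ ()
x∈p─q⇒x∉q (_ ∷ p) (_ ∷ q)       (there x∈) = λ { (there x∈q) → x∈p─q⇒x∉q p q x∈ x∈q }

module _ {n : ℕ} where

  module _ {p q : Subset n} {x : Fin n} (p─q≡x : p ─ q ≡ ⁅ x ⁆) where

    p─q≡⁅x⁆⇒x∈p : x ∈ p
    p─q≡⁅x⁆⇒x∈p = p─q⊆p p q (subst (x ∈_) (sym p─q≡x) (x∈⁅x⁆ x))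

    p─q≡⁅x⁆⇒x∉q : x ∉ q
    p─q≡⁅x⁆⇒x∉q = x∈p─q⇒x∉q p q (subst (x ∈_) (sym p─q≡x) (x∈⁅x⁆ x))

    p─q≡⁅x⁆⇒p-x⊆q : ∀ {y} → y ∈ p → y ≢ x → y ∈ q
    p─q≡⁅x⁆⇒p-x⊆q {y} y∈p y≢x with y ∈? q
    ... | yes y∈q = y∈q
    ... | no  y∉q = ⊥-elim (y≢x (x∈⁅y⁆⇒x≡y x (subst (y ∈_) p─q≡x (x∈p∧x∉q⇒x∈p─q y∈p y∉q))))

  x∈p⇒⁅x⁆⊆p : ∀ {x : Fin n} {p} → x ∈ p → ⁅ x ⁆ ⊆ p
  x∈p⇒⁅x⁆⊆p {x} {p} x∈p y∈⁅x⁆ = subst (_∈ p) (sym (x∈⁅y⁆⇒x≡y x y∈⁅x⁆)) x∈p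

  x∈p⇒1≤∣p∣ : ∀ {x : Fin n} {p} → x ∈ p → 1 ≤ ∣ p ∣
  x∈p⇒1≤∣p∣ {x} x∈p = subst (_≤ _) (∣⁅x⁆∣≡1 x) (p⊆q⇒∣p∣≤∣q∣ (x∈p⇒⁅x⁆⊆p x∈p))

  x∈p∧y∈p∧x≢y⇒2≤∣p∣ : ∀ {x y : Fin n} {p} → x ∈ p → y ∈ p → x ≢ y → 2 ≤ ∣ p ∣
  x∈p∧y∈p∧x≢y⇒2≤∣p∣ x∈p y∈p x≢y =
    ≤-trans (s≤s (x∈p⇒1≤∣p∣ (x∈p∧x∉q⇒x∈p─q y∈p (x≢y⇒x∉⁅y⁆ (x≢y ∘ sym))))) (x∈p⇒∣p-x∣<∣p∣ x∈p)

  2≤∣p∣⇒p≢⁅x⁆ : ∀ {x : Fin n} {p} → 2 ≤ ∣ p ∣ → p ≢ ⁅ x ⁆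
  2≤∣p∣⇒p≢⁅x⁆ {x} 2≤∣p∣ p≡x with subst (2 ≤_) (trans (cong ∣_∣ p≡x) (∣⁅x⁆∣≡1 x)) 2≤∣p∣
  ... | s≤s ()

  x∈p∧p≢⁅x⁆⇒∃y≢x : ∀ {x : Fin n} {p} → x ∈ p → p ≢ ⁅ x ⁆ → ∃[ y ] (y ∈ p × y ≢ x)
  x∈p∧p≢⁅x⁆⇒∃y≢x {x} {p} x∈p p≢x with any? (λ y → (y ∈? p) ×-dec ¬? (y ≟ᶠ x))
  ... | yes other = other
  ... | no ¬other = ⊥-elim (p≢x (⊆-antisym p⊆⁅x⁆ (x∈p⇒⁅x⁆⊆p x∈p)))
    where
    p⊆⁅x⁆ : p ⊆ ⁅ x ⁆
    p⊆⁅x⁆ {y} y∈p with y ≟ᶠ x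
    ... | yes refl = x∈⁅x⁆ x
    ... | no  y≢x  = ⊥-elim (¬other (y , y∈p , y≢x))

module GraphFacts (G : Graph) where
  open Graph G using (adj; irrefl) renaming (sym to adj-sym)

  Adj-sym : ∀ {x y} → Adj G x y → Adj G y x
  Adj-sym {x} {y} xy = trans (adj-sym y x) xy

  Adj⇒≢ : ∀ {x y} → Adj G x y → x ≢ y
  Adj⇒≢ {x} xx refl with trans (sym xx) (irrefl x)
  ... | ()

  Adj? : Decidable (Adj G)
  Adj? x y = adj x y ≟ᴮ true

  ∈nbr⇒Adj : ∀ {x y} → y ∈ nbr G x → Adj G x y
  ∈nbr⇒Adj {x} {y} y∈ = trans (sym (lookup∘tabulate (adj x) y)) ([]=⇒lookup y∈)

  Adj⇒∈nbr : ∀ {x y} → Adj G x y → y ∈ nbr G x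
  Adj⇒∈nbr {x} {y} xy = lookup⇒[]= y _ (trans (lookup∘tabulate (adj x) y) xy)

module ModuleBoundary (G : Graph) (M : Subset (Graph.n G)) (M-module : IsModule G M) where
  open GraphFacts G

  Boundary : V G → Set
  Boundary x = N G (_∈ M) x × x ∉ M

  Remote : V G → Set
  Remote x = x ∉ M × ¬ Boundary x

  boundary-complete : ∀ {x} → Boundary x → ∀ {y} → y ∈ M → Adj G x y
  boundary-complete {x} ((z , z∈M , xz) , x∉M) {y} y∈M with M-module x x∉M
  ... | inj₁ complete    = complete y y∈M
  ... | inj₂ anticomplete = ⊥-elim (anticomplete z z∈M xz)

  remote-anticomplete : ∀ {x} → Remote x → ∀ {y} → y ∈ M → ¬ Adj G x y
  remote-anticomplete (x∉M , ¬bx) y∈M xy = ¬bx ((_ , y∈M , xy) , x∉M)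

  RemoteEdgeClosed : Set
  RemoteEdgeClosed = ∀ {x a b} → Boundary x → Remote a → Remote b → Adj G x a → Adj G a b → Adj G x b

  forkFree⇒remoteEdgeClosed : ForkFree G → ∀ {p q} → p ∈ M → q ∈ M → p ≢ q → ¬ Adj G p q →
                               RemoteEdgeClosed
  forkFree⇒remoteEdgeClosed forkFree {p} {q} p∈M q∈M p≢q p≁q {x} {a} {b} bx ra rb xa ab
    with Adj? x b
  ... | yes xb = xb
  ... | no  x≁b = ⊥-elim (forkFree x p q a b
        ( out≢in (proj₂ bx) p∈M , out≢in (proj₂ bx) q∈M , Adj⇒≢ xa , (λ { refl → proj₂ rb bx })
        , p≢q , in≢out p∈M (proj₁ ra) , in≢out p∈M (proj₁ rb)
        , in≢out q∈M (proj₁ ra) , in≢out q∈M (proj₁ rb) , Adj⇒≢ ab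
        , boundary-complete bx p∈M , boundary-complete bx q∈M , xa , ab
        , x≁b , p≁q
        , remote-anticomplete ra p∈M ∘ Adj-sym , remote-anticomplete rb p∈M ∘ Adj-sym
        , remote-anticomplete ra q∈M ∘ Adj-sym , remote-anticomplete rb q∈M ∘ Adj-sym ))
    where
    out≢in : ∀ {y z} → y ∉ M → z ∈ M → y ≢ z
    out≢in y∉M z∈M refl = y∉M z∈M
    in≢out : ∀ {y z} → y ∈ M → z ∉ M → y ≢ z
    in≢out y∈M z∉M refl = z∉M y∈M

  Dominated : Subset (Graph.n G) → Set
  Dominated J = ∀ x → Boundary x → ∃[ c ] (c ∈ J × c ∉ M × Adj G x c)

  boundary∉independent⊇J∖M : ∀ {J S} → Dominated J → Independent G S → (∀ {c} → c ∈ J → c ∉ M → c ∈ S) →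
                              ∀ {y} → Boundary y → y ∉ S
  boundary∉independent⊇J∖M dom S-ind J∖M⊆S {y} by y∈S with dom y by
  ... | c , c∈J , c∉M , yc = S-ind y c y∈S (J∖M⊆S c∈J c∉M) yc

  ¬boundary-beside-M : ∀ {S m z} → Independent G S → m ∈ S → m ∈ M → z ∈ S → ¬ Boundary z
  ¬boundary-beside-M S-ind m∈S m∈M z∈S bz = S-ind _ _ z∈S m∈S (boundary-complete bz m∈M)

  remote-nbr∉M : ∀ {z y} → Remote z → Adj G z y → y ∉ M
  remote-nbr∉M rz zy y∈M = remote-anticomplete rz y∈M zy

  dominated⇒locallyBlocked : ∀ {I v} → v ∈ M → v ∈ I → Dominated I → LocallyBlocked G Boundary I
  dominated⇒locallyBlocked v∈M v∈I dom x bx with dom x bx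
  ... | c , c∈I , c∉M , xc =
    x∈p∧y∈p∧x≢y⇒2≤∣p∣ (x∈p∩q⁺ (c∈I , Adj⇒∈nbr xc)) (x∈p∩q⁺ (v∈I , Adj⇒∈nbr (boundary-complete bx v∈M)))
                      (λ { refl → c∉M v∈M })

  locallyBlocked⇒¬private : ∀ {I} → LocallyBlocked G Boundary I →
                            ∀ {v x} → Boundary x → I ∩ nbr G x ≢ ⁅ v ⁆
  locallyBlocked⇒¬private blocked bx = 2≤∣p∣⇒p≢⁅x⁆ (blocked _ bx)

  ¬private⇒dominated : ∀ {I v} → v ∈ M → v ∈ I → (∀ x → x ∈ M → x ∈ I → x ≡ v) →
                       (∀ {x} → Boundary x → I ∩ nbr G x ≢ ⁅ v ⁆) → Dominated I
  ¬private⇒dominated {I} v∈M v∈I v-unique ¬private x bx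
    with x∈p∧p≢⁅x⁆⇒∃y≢x (x∈p∩q⁺ (v∈I , Adj⇒∈nbr (boundary-complete bx v∈M))) (¬private bx)
  ... | c , c∈ , c≢v with x∈p∩q⁻ I _ c∈
  ... | c∈I , c∈nbr = c , c∈I , (λ c∈M → c≢v (v-unique c c∈M c∈I)) , ∈nbr⇒Adj c∈nbr

  module Sliding (closed : RemoteEdgeClosed) (v : V G) (v∈M : v ∈ M) where

    record Anchored (J : Subset (Graph.n G)) : Set where
      field
        token        : V G
        token∈J      : token ∈ J
        token∈C      : Component G M v token
        token-unique : ∀ z → z ∈ M → z ∈ J → z ≡ token
        dominated    : Dominated J

    anchored-start : ∀ {I} → v ∈ I → (∀ x → x ∈ M → x ∈ I → x ≡ v) → Dominated I → Anchored I
    anchored-start v∈I v-unique dom = record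
      { token = v ; token∈J = v∈I ; token∈C = v∈M , ε ; token-unique = v-unique ; dominated = dom }

    slide-preserves-anchored : ∀ {A B} → TSAdj G A B → Anchored A → Anchored B
    slide-preserves-anchored {A} {B} (A-ind , B-ind , a , b , ab , A─B≡a , B─A≡b) anc =
      [ moved , unmoved ]′ (toSum (a ≟ᶠ token))
      where
      open Anchored anc
      a∉B : a ∉ B
      a∉B = p─q≡⁅x⁆⇒x∉q A─B≡a
      b∈B : b ∈ B
      b∈B = p─q≡⁅x⁆⇒x∈p B─A≡b
      kept : ∀ {z} → z ∈ A → z ≢ a → z ∈ B
      kept = p─q≡⁅x⁆⇒p-x⊆q A─B≡a
      old : ∀ {z} → z ∈ B → z ≢ b → z ∈ A
      old = p─q≡⁅x⁆⇒p-x⊆q B─A≡b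
      token∈M : token ∈ M
      token∈M = proj₁ token∈C

      moved : a ≡ token → Anchored B
      moved refl = record
        { token = b ; token∈J = b∈B ; token∈C = b∈M , proj₂ token∈C ◅◅ (token∈M , b∈M , ab) ◅ ε
        ; token-unique = unique ; dominated = dom }
        where
        A∖M⊆B : ∀ {c} → c ∈ A → c ∉ M → c ∈ B
        A∖M⊆B c∈A c∉M = kept c∈A (λ { refl → c∉M token∈M })
        b∈M : b ∈ M
        b∈M with b ∈? M
        ... | yes b∈M = b∈M
        ... | no  b∉M = ⊥-elim (boundary∉independent⊇J∖M dominated B-ind A∖M⊆B
                                  ((a , token∈M , Adj-sym ab) , b∉M) b∈B)
        unique : ∀ z → z ∈ M → z ∈ B → z ≡ b
        unique z z∈M z∈B with z ≟ᶠ b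
        ... | yes z≡b = z≡b
        ... | no  z≢b = ⊥-elim (a∉B (subst (_∈ B) (token-unique z z∈M (old z∈B z≢b)) z∈B))
        dom : Dominated B
        dom x bx with dominated x bx
        ... | c , c∈A , c∉M , xc = c , A∖M⊆B c∈A c∉M , c∉M , xc

      unmoved : a ≢ token → Anchored B
      unmoved a≢m = record
        { token = token ; token∈J = token∈B ; token∈C = token∈C
        ; token-unique = unique ; dominated = dom }
        where
        token∈B : token ∈ B
        token∈B = kept token∈J (a≢m ∘ sym)
        ra : Remote a
        ra = (λ a∈M → a≢m (token-unique a a∈M (p─q≡⁅x⁆⇒x∈p A─B≡a)))
           , ¬boundary-beside-M A-ind token∈J token∈M (p─q≡⁅x⁆⇒x∈p A─B≡a)
        rb : Remote b
        rb = remote-nbr∉M ra ab , ¬boundary-beside-M B-ind token∈B token∈M b∈B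
        unique : ∀ z → z ∈ M → z ∈ B → z ≡ token
        unique z z∈M z∈B = token-unique z z∈M (old z∈B (λ { refl → proj₁ rb z∈M }))
        dom : Dominated B
        dom x bx with dominated x bx
        ... | c , c∈A , c∉M , xc with c ≟ᶠ a
        ... | yes refl = b , b∈B , proj₁ rb , closed bx ra rb xc ab
        ... | no  c≢a  = c , kept c∈A c≢a , c∉M , xc

    reach-preserves-anchored : ∀ {A B} → TSReach G A B → Anchored A → Anchored B
    reach-preserves-anchored ε         anc = anc
    reach-preserves-anchored (A↔A′ ◅ A′⇝B) anc =
      reach-preserves-anchored A′⇝B (slide-preserves-anchored A↔A′ anc)

    anchored⇒free-nbr-twin : ∀ {J} → Anchored J → Independent G J → ∀ {u y} → u ∈ J → FreeNbr G J u y →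
                              Twin G Boundary u y
    anchored⇒free-nbr-twin {J} anc J-ind {u} {y} u∈J (_ , uy , J′-ind) =
      [ twin-in-M , twin-outside-M ]′ (toSum (u ∈? M))
      where
      open Anchored anc
      stays : ∀ {c} → c ∈ J → c ≢ u → c ∈ (J - u) ∪ ⁅ y ⁆
      stays c∈J c≢u = x∈p∪q⁺ (inj₁ (x∈p∧x∉q⇒x∈p─q c∈J (x≢y⇒x∉⁅y⁆ c≢u)))
      joins : y ∈ (J - u) ∪ ⁅ y ⁆
      joins = x∈p∪q⁺ (inj₂ (x∈⁅x⁆ y))
      token∈M : token ∈ M
      token∈M = proj₁ token∈C

      twin-in-M : u ∈ M → Twin G Boundary u y
      twin-in-M u∈M = (λ by → proj₂ by y∈M) , Adj⇒≢ uy ∘ sym , uy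
                    , λ w bw → mk⇔ (λ _ → Adj-sym (boundary-complete bw u∈M))
                                   (λ _ → Adj-sym (boundary-complete bw y∈M))
        where
        y∈M : y ∈ M
        y∈M with y ∈? M
        ... | yes y∈M = y∈M
        ... | no  y∉M = ⊥-elim (boundary∉independent⊇J∖M dominated J′-ind
                                  (λ c∈J c∉M → stays c∈J (λ { refl → c∉M u∈M }))
                                  ((u , u∈M , Adj-sym uy) , y∉M) joins)

      twin-outside-M : u ∉ M → Twin G Boundary u y
      twin-outside-M u∉M = proj₂ ry , Adj⇒≢ uy ∘ sym , uy
                         , λ w bw → mk⇔ (λ yw → Adj-sym (closed bw ry ru (Adj-sym yw) (Adj-sym uy)))
                                        (λ uw → Adj-sym (closed bw ru ry (Adj-sym uw) uy))
        where
        ru : Remote u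
        ru = u∉M , ¬boundary-beside-M J-ind token∈J token∈M u∈J
        ry : Remote y
        ry = remote-nbr∉M ru uy
           , ¬boundary-beside-M J′-ind (stays token∈J (λ { refl → u∉M token∈M })) token∈M joins

    dominated⇒permanentlyBlocked : ∀ {I} → v ∈ I → (∀ x → x ∈ M → x ∈ I → x ≡ v) → Dominated I →
                                   PermanentlyBlocked G Boundary I
    dominated⇒permanentlyBlocked v∈I v-unique dom =
      dominated⇒locallyBlocked v∈M v∈I dom ,
      λ I′ I′-ind I⇝I′ u _ u∈I′ y free →
        anchored⇒free-nbr-twin (reach-preserves-anchored I⇝I′ start) I′-ind u∈I′ free
      where
      start : Anchored _
      start = anchored-start v∈I v-unique dom

    anchored⇒unique-token : ∀ {J} → Anchored J →
      ∃[ x ] (x ∈ J × Component G M v x × (∀ y → y ∈ J → Component G M v y → y ≡ x))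
    anchored⇒unique-token anc = token , token∈J , token∈C , λ y y∈J (y∈M , _) → token-unique y y∈M y∈J
      where open Anchored anc

lemma6p2 : (G : Graph) → ForkFree G →
    (I : Subset (Graph.n G)) → Independent G I →
    (∀ x → ∣ I ∩ nbr G x ∣ ≤ 2) →
    (M : Subset (Graph.n G)) → IsModule G M → NonTrivial G M →
    (v : V G) → v ∈ M → v ∈ I → (∀ x → x ∈ M → x ∈ I → x ≡ v) →
    (∃[ w ] (w ∈ M × ¬ Star (AdjIn G M) v w)) →
    let X = λ x → N G (λ y → y ∈ M) x × x ∉ M in
    ExactlyOne (∃[ c ] (c ∉ M × Adj G v c × I ∩ nbr G c ≡ ⁅ v ⁆))
               (PermanentlyBlocked G X I)
    × (PermanentlyBlocked G X I →
        ∀ I' → Independent G I' → TSReach G I I' →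
        ∃[ x ] (x ∈ I' × Component G M v x
                × (∀ y → y ∈ I' → Component G M v y → y ≡ x)))
lemma6p2 G forkFree I _ _ M M-module _ v v∈M v∈I v-unique (w , w∈M , v↛w) =
  ExactlyOne-intro privateNbr? (dominated⇒permanentlyBlocked v∈I v-unique ∘ ¬privateNbr⇒dominated)
                   blocked⇒¬privateNbr ,
  λ blocked I′ _ I⇝I′ → anchored⇒unique-token (reach-preserves-anchored I⇝I′ (start blocked))
  where
  open GraphFacts G
  open ModuleBoundary G M M-module

  v≢w : v ≢ w
  v≢w refl = v↛w ε

  v≁w : ¬ Adj G v w
  v≁w vw = v↛w ((v∈M , w∈M , vw) ◅ ε)

  open Sliding (forkFree⇒remoteEdgeClosed forkFree v∈M w∈M v≢w v≁w) v v∈M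

  PrivateNbr : Set
  PrivateNbr = ∃[ c ] (c ∉ M × Adj G v c × I ∩ nbr G c ≡ ⁅ v ⁆)

  privateNbr? : Dec PrivateNbr
  privateNbr? = any? λ c → ¬? (c ∈? M) ×-dec Adj? v c ×-dec ≡-dec _≟ᴮ_ (I ∩ nbr G c) ⁅ v ⁆

  ¬privateNbr⇒dominated : ¬ PrivateNbr → Dominated I
  ¬privateNbr⇒dominated ¬private = ¬private⇒dominated v∈M v∈I v-unique
    λ bc I∩Nc≡v → ¬private (_ , proj₂ bc , Adj-sym (boundary-complete bc v∈M) , I∩Nc≡v)

  blocked⇒¬privateNbr : PermanentlyBlocked G Boundary I → ¬ PrivateNbr
  blocked⇒¬privateNbr (locally , _) (c , c∉M , vc , I∩Nc≡v) =
    locallyBlocked⇒¬private locally ((v , v∈M , Adj-sym vc) , c∉M) I∩Nc≡v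

  start : PermanentlyBlocked G Boundary I → Anchored I
  start (locally , _) = anchored-start v∈I v-unique
    (¬private⇒dominated v∈M v∈I v-unique (locallyBlocked⇒¬private locally))
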